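{- Let $G=(V,E)$ be a simple $2$-edge-connected graph. Then $G$ has at least one spanning tree $T\subset E$ which has an absorption order in $G$.
   Context: $2$-edge-connected means connected with no cut-edge. A spanning tree $T$ of connected $G$ has an absorption order in $G$ if $V\sqcup T$ can be linearly ordered so that: (i) the order begins with a vertex $v_0$ followed by an edge $e_0\in T$, where $e_0$ is the unique edge of $T$ incident to $v_0$; (ii) for every vertex $v\neq v_0$ there is an edge $e=\{v,w\}\in E$ with $w$ earlier than $v$, and with $e\in E\setminus T$ or $e$ earlier than $v$; (iii) for every edge $e\in T\setminus\{e_0\}$ there is a vertex $v$ incident to $e$ occurring earlier than $e$ such that every other edge incident to $v$ either lies in $E\setminus T$ or occurs earlier than $e$. -}

module Defs where

open import Data.Nat using (ℕ; _≤_; _<_)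
open import Data.Fin using (Fin; _≟_)
open import Data.Bool using (Bool; true; false; _∧_; _∨_; not)
open import Data.List using (List; []; _∷_; _++_; length)
open import Data.List.Relation.Unary.Unique.Propositional using (Unique)
open import Data.Product using (Σ; _×_; ∃; ∃-syntax; _,_)
open import Data.Sum using (_⊎_)
open import Data.Unit using (⊤)
open import Relation.Nullary using (¬_)
open import Relation.Nullary.Decidable using (⌊_⌋)
open import Relation.Binary.PropositionalEquality using (_≡_; _≢_)
open import Relation.Binary.Construct.Closure.ReflexiveTransitive using (Star)

record SimpleGraph (n : ℕ) : Set where
  field
    adj    : Fin n → Fin n → Bool
    sym    : ∀ u v → adj u v ≡ adj v u
    irrefl : ∀ v → adj v v ≡ false
open SimpleGraph public

EdgeRel : ℕ → Set
EdgeRel n = Fin n → Fin n → Bool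

Edge : ∀ {n} → EdgeRel n → Fin n → Fin n → Set
Edge R u v = R u v ≡ true

Connected : ∀ {n} → EdgeRel n → Set
Connected {n} R = ∀ (u v : Fin n) → Star (Edge R) u v

sameEdge : ∀ {n} → Fin n → Fin n → Fin n → Fin n → Bool
sameEdge a b u v = (⌊ a ≟ u ⌋ ∧ ⌊ b ≟ v ⌋) ∨ (⌊ a ≟ v ⌋ ∧ ⌊ b ≟ u ⌋)

deleteEdge : ∀ {n} → EdgeRel n → Fin n → Fin n → EdgeRel n
deleteEdge R u v a b = R a b ∧ not (sameEdge a b u v)

TwoEdgeConnected : ∀ {n} → SimpleGraph n → Set
TwoEdgeConnected G =
  Connected (adj G) ×
  (∀ u v → Edge (adj G) u v → Connected (deleteEdge (adj G) u v))

Chain : ∀ {n} → EdgeRel n → List (Fin n) → Set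
Chain R []           = ⊤
Chain R (x ∷ [])     = ⊤
Chain R (x ∷ y ∷ xs) = Edge R x y × Chain R (y ∷ xs)

HasCycle : ∀ {n} → EdgeRel n → Set
HasCycle {n} R = ∃[ x ] ∃[ xs ] (2 ≤ length xs × Unique (x ∷ xs) × Chain R (x ∷ xs ++ x ∷ []))

IsSpanningTree : ∀ {n} → SimpleGraph n → EdgeRel n → Set
IsSpanningTree G T =
  (∀ u v → T u v ≡ T v u) ×
  (∀ u v → Edge T u v → Edge (adj G) u v) ×
  Connected T ×
  ¬ HasCycle T

-- A linear order on V ⊔ T, given by an injective rank into ℕ:
-- vr v is the position of vertex v, er u v = er v u the position of the T-edge {u,v}.
-- (er is only meaningful on edges of T.)
record LinearOrderVT {n} (T : EdgeRel n) : Set where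
  field
    vr     : Fin n → ℕ
    er     : Fin n → Fin n → ℕ
    er-sym : ∀ u v → er u v ≡ er v u
    vr-inj : ∀ u v → vr u ≡ vr v → u ≡ v
    er-inj : ∀ a b u v → Edge T a b → Edge T u v → er a b ≡ er u v → sameEdge a b u v ≡ true
    ve-dis : ∀ w u v → Edge T u v → vr w ≢ er u v
open LinearOrderVT public

HasAbsorptionOrder : ∀ {n} → SimpleGraph n → EdgeRel n → Set
HasAbsorptionOrder {n} G T =
  Σ (LinearOrderVT T) λ O → ∃[ v₀ ] ∃[ u₀ ] (
    -- (i) e₀ = {v₀,u₀} ∈ T is the unique T-edge at v₀; order begins v₀, e₀
    Edge T v₀ u₀ ×
    (∀ w → Edge T v₀ w → w ≡ u₀) ×
    vr O v₀ < er O v₀ u₀ ×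
    (∀ w → w ≢ v₀ → er O v₀ u₀ < vr O w) ×
    (∀ a b → Edge T a b → sameEdge a b v₀ u₀ ≡ false → er O v₀ u₀ < er O a b) ×
    (∀ v → v ≢ v₀ → ∃[ w ] (Edge (adj G) v w × vr O w < vr O v ×
        (T v w ≡ false ⊎ er O v w < vr O v))) ×
    (∀ a b → Edge T a b → sameEdge a b v₀ u₀ ≡ false →
        let Absorbs : Fin n → Fin n → Set
            Absorbs x y = vr O x < er O a b ×
              (∀ z → Edge (adj G) x z → z ≢ y → T x z ≡ false ⊎ er O x z < er O a b)
        in Absorbs a b ⊎ Absorbs b a))

-- Take v₀ to be the last vertex of a search order, so that G − v₀ stays connected, and start from
-- the tree {e₀} with e₀ = {v₀,u₀}, ordered v₀, e₀, u₀. While some vertex is missed, leave the current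
-- vertex set S along an edge {s,y₁} with s ≠ v₀; as {s,y₁} is no cut-edge, a walk back into S avoids
-- it, and loop erasure turns it into an ear q z₀ … z_m p outside S, oriented so that q precedes p.
-- Placing z₀, {z₀,z₁}, z₁, …, z_m, {z_m,p} right after q keeps all conditions: z₀ is reached from q by
-- a non-tree edge, each further z through the tree edge just placed, each new edge is absorbed by its
-- first end, and the edge absorbed by p came after p, hence after the gap. Finally the absorption
-- condition itself rules out cycles: along a non-backtracking walk edge ranks first rise, then fall.

module Submission where

open import Defs hiding (sym; vr; er; er-sym; vr-inj; er-inj; ve-dis)
open import Data.Nat using (ℕ; zero; suc; _+_; _≤_; _<_; z≤n; s≤s; _⊔_; _<?_; _≤?_)
open import Data.Nat.Properties
  using (≤-refl; ≤-trans; ≤-pred; <-trans; <-irrefl; <-asym; <-≤-trans; ≤-<-trans; <⇒≤; ≮⇒≥; ≰⇒>; <-cmp; n≮0;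
         n<1+n; n≤1+n; m≤m+n; m≤n⇒m≤1+n; +-suc; +-identityʳ; +-monoʳ-<; +-monoˡ-<; +-monoˡ-≤; +-cancelˡ-≡;
         m≤m⊔n; m≤n⊔m; ⊔-lub)
open import Data.Fin using (Fin; zero; suc; _≟_)
open import Data.Fin.Properties using (0≢1+n; any?)
open import Data.Bool using (Bool; true; false; _∧_; _∨_; not; if_then_else_)
open import Data.Bool.Properties using (T-≡; T-∧; T-∨; ∧-comm; ∨-comm; ∨-zeroʳ) renaming (_≟_ to _≟ᵇ_)
open import Data.Maybe using (Maybe; just; nothing; is-just; fromMaybe)
open import Data.Maybe.Properties using (just-injective)
open import Data.List using (List; []; _∷_; _++_; _ʳ++_; _∷ʳ_; length; allFin)
open import Data.List.Properties using (++-assoc; ++-ʳ++; ∷-injectiveʳ)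
open import Data.List.Membership.Propositional using (_∈_)
open import Data.List.Membership.Propositional.Properties using (∈-allFin; ∈-∃++)
import Data.List.Membership.DecPropositional as DecMembership
open import Data.List.Relation.Unary.Any using (here; there)
open import Data.List.Relation.Unary.All using (All; []; _∷_; lookup; universal) renaming (map to All-map; head to All-head)
open import Data.List.Relation.Unary.All.Properties using (All¬⇒¬Any; ¬Any⇒All¬; ++⁻ʳ)
open import Data.List.Relation.Unary.AllPairs using ([]; _∷_)
open import Data.List.Relation.Unary.Unique.Propositional using (Unique)
open import Data.Product using (Σ; _×_; ∃; ∃-syntax; ∃₂; _,_; proj₁; proj₂)
open import Data.Sum using (_⊎_; inj₁; inj₂; [_,_])
import Data.Sum
open import Data.Unit using (⊤; tt)
open import Data.Empty using (⊥; ⊥-elim)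
open import Function using (Equivalence)
open import Relation.Nullary using (¬_; Dec; yes; no)
open import Relation.Nullary.Decidable using (⌊_⌋; toWitness; fromWitness)
open import Relation.Binary using (tri<; tri≈; tri>)
open import Relation.Binary.PropositionalEquality using (_≡_; _≢_; refl; sym; trans; cong; cong₂; subst; subst₂)
open import Relation.Binary.Construct.Closure.ReflexiveTransitive using (Star; ε; _◅_; _◅◅_)
  renaming (reverse to Star-reverse; map to Star-map)

open Equivalence using (to; from)

≡true⇒≢false : ∀ {b} → b ≡ true → b ≢ false
≡true⇒≢false refl ()

SameEnds : ∀ {n} → Fin n → Fin n → Fin n → Fin n → Set
SameEnds a b u v = (a ≡ u × b ≡ v) ⊎ (a ≡ v × b ≡ u)

sameEdge-sound : ∀ {n} {a b u v : Fin n} → sameEdge a b u v ≡ true → SameEnds a b u v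
sameEdge-sound {a = a} {b} {u} {v} h
  with to (T-∨ {⌊ a ≟ u ⌋ ∧ ⌊ b ≟ v ⌋}) (from T-≡ h)
... | inj₁ t = let (p , q) = to (T-∧ {⌊ a ≟ u ⌋}) t in inj₁ (toWitness p , toWitness q)
... | inj₂ t = let (p , q) = to (T-∧ {⌊ a ≟ v ⌋}) t in inj₂ (toWitness p , toWitness q)

sameEdge-complete : ∀ {n} {a b u v : Fin n} → SameEnds a b u v → sameEdge a b u v ≡ true
sameEdge-complete {a = a} {b} {u} {v} (inj₁ (p , q)) =
  to T-≡ (from (T-∨ {⌊ a ≟ u ⌋ ∧ ⌊ b ≟ v ⌋}) (inj₁ (from (T-∧ {⌊ a ≟ u ⌋}) (fromWitness p , fromWitness q))))
sameEdge-complete {a = a} {b} {u} {v} (inj₂ (p , q)) =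
  to T-≡ (from (T-∨ {⌊ a ≟ u ⌋ ∧ ⌊ b ≟ v ⌋}) (inj₂ (from (T-∧ {⌊ a ≟ v ⌋}) (fromWitness p , fromWitness q))))

sameEdge-refl : ∀ {n} (a b : Fin n) → sameEdge a b a b ≡ true
sameEdge-refl a b = sameEdge-complete {a = a} {b} {a} {b} (inj₁ (refl , refl))

sameEdge-flip : ∀ {n} (a b : Fin n) → sameEdge a b b a ≡ true
sameEdge-flip a b = sameEdge-complete {a = a} {b} {b} {a} (inj₂ (refl , refl))

sameEdge-distinct : ∀ {n} {a b u v : Fin n} → ¬ SameEnds a b u v → sameEdge a b u v ≡ false
sameEdge-distinct {a = a} {b} {u} {v} h with sameEdge a b u v in eq
... | true  = ⊥-elim (h (sameEdge-sound eq))
... | false = refl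

sameEdge-comm : ∀ {n} (a b u v : Fin n) → sameEdge a b u v ≡ sameEdge b a u v
sameEdge-comm a b u v =
  trans (cong₂ _∨_ (∧-comm ⌊ a ≟ u ⌋ ⌊ b ≟ v ⌋) (∧-comm ⌊ a ≟ v ⌋ ⌊ b ≟ u ⌋)) (∨-comm (⌊ b ≟ v ⌋ ∧ ⌊ a ≟ u ⌋) _)

sameEdge-trans : ∀ {n} {a b u v x y : Fin n} →
  sameEdge a b x y ≡ true → sameEdge u v x y ≡ true → sameEdge a b u v ≡ true
sameEdge-trans {a = a} {b} {u} {v} {x} {y} h₁ h₂
  with sameEdge-sound {a = a} {b} {x} {y} h₁ | sameEdge-sound {a = u} {v} {x} {y} h₂
... | inj₁ (refl , refl) | inj₁ (refl , refl) = sameEdge-refl a b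
... | inj₁ (refl , refl) | inj₂ (refl , refl) = sameEdge-flip a b
... | inj₂ (refl , refl) | inj₁ (refl , refl) = sameEdge-flip a b
... | inj₂ (refl , refl) | inj₂ (refl , refl) = sameEdge-refl a b

Edge-sym : ∀ {n} {R : EdgeRel n} → (∀ u v → R u v ≡ R v u) → ∀ {u v} → Edge R u v → Edge R v u
Edge-sym R-sym {u} {v} e = trans (R-sym v u) e

deleted-edge : ∀ {n} (R : EdgeRel n) u v a b → Edge (deleteEdge R u v) a b → Edge R a b × sameEdge a b u v ≡ false
deleted-edge R u v a b h with R a b | sameEdge a b u v
... | true | false = refl , refl

NonBacktracking : ∀ {n} → List (Fin n) → Set
NonBacktracking (a ∷ b ∷ c ∷ rest) = a ≢ c × NonBacktracking (b ∷ c ∷ rest)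
NonBacktracking _                  = ⊤

Chain-snoc : ∀ {n} (R : EdgeRel n) (ys : List (Fin n)) {z w} →
  Chain R (ys ++ z ∷ []) → Edge R z w → Chain R (ys ++ z ∷ w ∷ [])
Chain-snoc R []               _         r = r , tt
Chain-snoc R (y ∷ [])         (r₁ , _)  r = r₁ , r , tt
Chain-snoc R (y ∷ y′ ∷ ys)    (r₁ , c)  r = r₁ , Chain-snoc R (y′ ∷ ys) c r

unrolled-nonBacktracking : ∀ {n} (x c p q : Fin n) ys → Unique (p ∷ q ∷ ys) → p ≢ x → All (x ≢_) (q ∷ ys) →
  All (c ≢_) (q ∷ ys) → NonBacktracking (p ∷ q ∷ ys ++ x ∷ c ∷ [])
unrolled-nonBacktracking x c p q [] _ p≢x _ (c≢q ∷ []) = p≢x , (λ e → c≢q (sym e)) , tt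
unrolled-nonBacktracking x c p q (r ∷ ys) ((_ ∷ p≢r ∷ _) ∷ u) p≢x (x≢q ∷ x≢ys) (_ ∷ c≢ys) =
  p≢r , unrolled-nonBacktracking x c q r ys u (λ e → x≢q (sym e)) x≢ys c≢ys

ʳ++-∷ʳ : ∀ {A : Set} (xs : List A) {ys z} → xs ʳ++ (ys ∷ʳ z) ≡ (xs ʳ++ ys) ∷ʳ z
ʳ++-∷ʳ []       = refl
ʳ++-∷ʳ (x ∷ xs) = ʳ++-∷ʳ xs

ʳ++-singleton : ∀ {A : Set} (xs : List A) {y b bs} → xs ʳ++ (y ∷ []) ≡ b ∷ bs → bs ≡ [] → xs ≡ []
ʳ++-singleton []       _  _    = refl
ʳ++-singleton (x ∷ xs) eq refl = ⊥-elim (too-long xs eq)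
  where
  too-long : ∀ {A : Set} (xs : List A) {a c cs b} → xs ʳ++ (a ∷ c ∷ cs) ≢ b ∷ []
  too-long []       ()
  too-long (x ∷ xs) = too-long xs

ʳ++-nonempty : ∀ {A : Set} (xs : List A) y ys → ∃₂ λ b bs → xs ʳ++ (y ∷ ys) ≡ b ∷ bs
ʳ++-nonempty []       y ys = y , ys , refl
ʳ++-nonempty (x ∷ xs) y ys = ʳ++-nonempty xs x (y ∷ ys)

All-ʳ++ : ∀ {A : Set} {P : A → Set} {xs acc} → All P xs → All P acc → All P (xs ʳ++ acc)
All-ʳ++ []         pacc = pacc
All-ʳ++ (px ∷ pxs) pacc = All-ʳ++ pxs (px ∷ pacc)

Unique-ʳ++ : ∀ {A : Set} {xs acc : List A} → Unique xs → Unique acc → All (λ x → All (x ≢_) acc) xs →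
  Unique (xs ʳ++ acc)
Unique-ʳ++ []             uacc _              = uacc
Unique-ʳ++ (x∉xs ∷ uxs) uacc (x∉acc ∷ apart) = Unique-ʳ++ uxs (x∉acc ∷ uacc) (zip-apart x∉xs apart)
  where
  zip-apart : ∀ {x ys acc} → All (x ≢_) ys → All (λ y → All (y ≢_) acc) ys → All (λ y → All (y ≢_) (x ∷ acc)) ys
  zip-apart []             []             = []
  zip-apart (x≢y ∷ x≢ys) (y∉ ∷ ys∉) = ((λ y≡x → x≢y (sym y≡x)) ∷ y∉) ∷ zip-apart x≢ys ys∉

Chain-ʳ++ : ∀ {n} {R : EdgeRel n} → (∀ u v → R u v ≡ R v u) → ∀ x xs {acc} →
  Chain R (x ∷ xs) → Chain R (x ∷ acc) → Chain R (xs ʳ++ (x ∷ acc))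
Chain-ʳ++ R-sym x []       _         cacc = cacc
Chain-ʳ++ R-sym x (y ∷ ys) (xy , cy) cacc = Chain-ʳ++ R-sym y ys cy (Edge-sym R-sym xy , cacc)

Unique-drop : ∀ {A : Set} (ys : List A) {zs} → Unique (ys ++ zs) → Unique zs
Unique-drop []       u       = u
Unique-drop (y ∷ ys) (_ ∷ u) = Unique-drop ys u

Chain-drop : ∀ {n} {R : EdgeRel n} (ys : List (Fin n)) {w zs} → Chain R (ys ++ w ∷ zs) → Chain R (w ∷ zs)
Chain-drop []            c       = c
Chain-drop (y ∷ [])      (_ , c) = c
Chain-drop (y ∷ y′ ∷ ys) (_ , c) = Chain-drop (y′ ∷ ys) c

∷ʳ-drop : ∀ {A : Set} (ys : List A) {w zs y} pre → pre ∷ʳ y ≡ ys ++ w ∷ zs → ∃[ pre′ ] (w ∷ zs ≡ pre′ ∷ʳ y)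
∷ʳ-drop []       pre       eq = pre , sym eq
∷ʳ-drop (_ ∷ [])     []        ()
∷ʳ-drop (_ ∷ _ ∷ _)  []        ()
∷ʳ-drop (_ ∷ ys)     (_ ∷ pre) eq = ∷ʳ-drop ys pre (∷-injectiveʳ eq)

∷ʳ-singleton : ∀ {A : Set} {h y : A} pre → h ∷ [] ≡ pre ∷ʳ y → h ≡ y
∷ʳ-singleton []          refl = refl
∷ʳ-singleton (_ ∷ [])    ()
∷ʳ-singleton (_ ∷ _ ∷ _) ()

VertexSet : ℕ → Set
VertexSet n = Fin n → Bool

_⊆ᵇ_ : ∀ {n} → VertexSet n → VertexSet n → Set
S ⊆ᵇ S′ = ∀ v → S v ≡ true → S′ v ≡ true

_⊂ᵇ_ : ∀ {n} → VertexSet n → VertexSet n → Set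
S ⊂ᵇ S′ = S ⊆ᵇ S′ × ∃[ y ] (S y ≡ false × S′ y ≡ true)

missing : ∀ {n} → VertexSet n → List (Fin n) → ℕ
missing S []       = 0
missing S (x ∷ xs) with S x
... | true  = missing S xs
... | false = suc (missing S xs)

missing-antitone : ∀ {n} {S S′ : VertexSet n} → S ⊆ᵇ S′ → ∀ xs → missing S′ xs ≤ missing S xs
missing-antitone sub [] = z≤n
missing-antitone {S = S} {S′} sub (x ∷ xs) with S x in e | S′ x in e′
... | true  | true  = missing-antitone sub xs
... | true  | false = ⊥-elim (≡true⇒≢false (sub x e) e′)
... | false | true  = m≤n⇒m≤1+n (missing-antitone sub xs)
... | false | false = s≤s (missing-antitone sub xs)

missing-strict : ∀ {n} {S S′ : VertexSet n} → S ⊆ᵇ S′ → ∀ {y} xs → y ∈ xs → S y ≡ false → S′ y ≡ true →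
  missing S′ xs < missing S xs
missing-strict {S = S} {S′} sub (x ∷ xs) (here refl) out in′ with S x | S′ x
... | true  | _     = ⊥-elim (≡true⇒≢false refl out)
... | false | false = ⊥-elim (≡true⇒≢false in′ refl)
... | false | true  = s≤s (missing-antitone sub xs)
missing-strict {S = S} {S′} sub (x ∷ xs) (there y∈xs) out in′ with S x in e | S′ x in e′
... | true  | true  = missing-strict sub xs y∈xs out in′
... | true  | false = ⊥-elim (≡true⇒≢false (sub x e) e′)
... | false | true  = m≤n⇒m≤1+n (missing-strict sub xs y∈xs out in′)
... | false | false = s≤s (missing-strict sub xs y∈xs out in′)

full? : ∀ {n} (S : VertexSet n) → (∃[ v ] S v ≡ false) ⊎ (∀ v → S v ≡ true)
full? S with any? (λ v → S v ≟ᵇ false)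
... | yes out = inj₁ out
... | no ¬out = inj₂ full
  where
  full : ∀ v → S v ≡ true
  full v with S v in e
  ... | true  = refl
  ... | false = ⊥-elim (¬out (v , e))

saturate : ∀ {n} (P : VertexSet n → Set) →
  (∀ S → P S → ∀ v → S v ≡ false → ∃[ S′ ] (P S′ × S ⊂ᵇ S′)) →
  ∀ S → P S → ∃[ S ] (P S × ∀ v → S v ≡ true)
saturate {n} P grow S PS = go (suc (missing S (allFin n))) S ≤-refl PS
  where
  go : ∀ m S → missing S (allFin n) < m → P S → ∃[ S ] (P S × ∀ v → S v ≡ true)
  go m S bound PS with full? S
  ... | inj₂ full = S , PS , full
  go (suc m) S (s≤s bound) PS | inj₁ (v , out) with grow S PS v out
  ... | S′ , PS′ , sub , y , y∉S , y∈S′ =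
    go m S′ (<-≤-trans (missing-strict sub (allFin n) (∈-allFin y) y∉S y∈S′) bound) PS′

update : ∀ {n} {A : Set} → (Fin n → A) → Fin n → A → Fin n → A
update f y b a = if ⌊ a ≟ y ⌋ then b else f a

update-here : ∀ {n} {A : Set} (f : Fin n → A) y b → update f y b y ≡ b
update-here f y b with y ≟ y
... | yes _ = refl
... | no y≢y = ⊥-elim (y≢y refl)

update-other : ∀ {n} {A : Set} (f : Fin n → A) {y} b {a} → a ≢ y → update f y b a ≡ f a
update-other f {y} b {a} a≢y with a ≟ y
... | yes a≡y = ⊥-elim (a≢y a≡y)
... | no _ = refl

⁅_⁆ : ∀ {n} → Fin n → VertexSet n
⁅ r ⁆ = update (λ _ → false) r true

exit-edge : ∀ {n} {R : Fin n → Fin n → Set} (S : VertexSet n) {a b} → Star R a b → S a ≡ true → S b ≡ false →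
  ∃[ x ] ∃[ y ] (R x y × S x ≡ true × S y ≡ false)
exit-edge S ε a∈S b∉S = ⊥-elim (≡true⇒≢false a∈S b∉S)
exit-edge S {a} (_◅_ {j = j} r rs) a∈S b∉S with S j in j∈S
... | true  = exit-edge S rs j∈S b∉S
... | false = a , j , r , a∈S , j∈S

module Absorption {n : ℕ} (T : EdgeRel n) (er : Fin n → Fin n → ℕ)
  (er-sym : ∀ u v → er u v ≡ er v u) (T-sym : ∀ u v → T u v ≡ T v u) where

  LastAt : Fin n → Fin n → Set
  LastAt x y = ∀ z → Edge T x z → z ≢ y → er x z < er x y

  module _ (absorbed : ∀ a b → Edge T a b → LastAt a b ⊎ LastAt b a) where

    finalRank : Fin n → Fin n → List (Fin n) → ℕ
    finalRank u v []      = er u v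
    finalRank u v (w ∷ L) = finalRank v w L

    FinalForward : Fin n → Fin n → List (Fin n) → Set
    FinalForward u v []      = LastAt v u
    FinalForward u v (w ∷ L) = FinalForward v w L

    finalRank-++ : ∀ u v M a b → finalRank u v (M ++ a ∷ b ∷ []) ≡ er a b
    finalRank-++ u v []      a b = refl
    finalRank-++ u v (w ∷ M) a b = finalRank-++ v w M a b

    FinalForward-++ : ∀ u v M a b → FinalForward u v (M ++ a ∷ b ∷ []) → LastAt b a
    FinalForward-++ u v []      a b h = h
    FinalForward-++ u v (w ∷ M) a b h = FinalForward-++ v w M a b h

    -- bc cannot be last at b as well, so it is last at c.
    forward-step : ∀ {a b c} → Edge T a b → Edge T b c → a ≢ c → LastAt b a →
      er b c < er a b × LastAt c b
    forward-step {a} {b} {c} tab tbc a≢c ab = drop , next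
      where
      drop : er b c < er a b
      drop = subst (er b c <_) (er-sym b a) (ab c tbc (λ e → a≢c (sym e)))
      next : LastAt c b
      next with absorbed b c tbc
      ... | inj₂ h = h
      ... | inj₁ h = ⊥-elim (<-asym drop (subst (_< er b c) (er-sym b a) (h a (trans (T-sym b a) tab) a≢c)))

    forward-descends : ∀ a b c L → Chain T (a ∷ b ∷ c ∷ L) → NonBacktracking (a ∷ b ∷ c ∷ L) →
      LastAt b a → finalRank b c L < er a b × FinalForward b c L
    forward-descends a b c [] (tab , tbc , _) (a≢c , _) ab = forward-step tab tbc a≢c ab
    forward-descends a b c (d ∷ L) (tab , tbc , ch) (a≢c , nb) ab with forward-step tab tbc a≢c ab
    ... | drop , bc with forward-descends b c d L (tbc , ch) nb bc
    ... | drop′ , final = <-trans drop′ drop , final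

    rises : ∀ {a b c} → Edge T a b → a ≢ c → LastAt b c → er a b < er b c
    rises {a} {b} {c} tab a≢c bc = subst (_< er b c) (er-sym b a) (bc a (trans (T-sym b a) tab) a≢c)

    -- Along a non-backtracking walk the ranks rise until the first edge that is last at its far end,
    -- and from there on fall.
    rise-or-descend : ∀ a b c L → Chain T (a ∷ b ∷ c ∷ L) → NonBacktracking (a ∷ b ∷ c ∷ L) →
      er a b < finalRank b c L ⊎ FinalForward b c L
    rise-or-descend a b c [] (tab , tbc , _) (a≢c , _) with absorbed b c tbc
    ... | inj₁ bc = inj₁ (rises tab a≢c bc)
    ... | inj₂ cb = inj₂ cb
    rise-or-descend a b c (d ∷ L) (tab , tbc , ch) (a≢c , nb) with absorbed b c tbc
    ... | inj₂ cb = inj₂ (proj₂ (forward-descends b c d L (tbc , ch) nb cb))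
    ... | inj₁ bc with rise-or-descend b c d L (tbc , ch) nb
    ...   | inj₁ rise  = inj₁ (<-trans (rises tab a≢c bc) rise)
    ...   | inj₂ final = inj₂ final

    -- The walk x c₁ c₂ … x c₁ would give its first edge a rank below its own.
    unrolled-cycle-impossible : ∀ x c₁ c₂ xs → Chain T (x ∷ c₁ ∷ c₂ ∷ xs ++ x ∷ c₁ ∷ []) →
      NonBacktracking (x ∷ c₁ ∷ c₂ ∷ xs ++ x ∷ c₁ ∷ []) → ⊥
    unrolled-cycle-impossible x c₁ c₂ xs walk nb with rise-or-descend x c₁ c₂ (xs ++ x ∷ c₁ ∷ []) walk nb
    ... | inj₁ rise  = <-irrefl (sym (finalRank-++ c₁ c₂ xs x c₁)) rise
    ... | inj₂ final = <-irrefl (finalRank-++ c₁ c₂ xs x c₁)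
      (proj₁ (forward-descends x c₁ c₂ _ walk nb (FinalForward-++ c₁ c₂ xs x c₁ final)))

    absorbed⇒acyclic : ¬ HasCycle T
    absorbed⇒acyclic (x , [] , () , _)
    absorbed⇒acyclic (x , _ ∷ [] , s≤s () , _)
    absorbed⇒acyclic (x , c₁ ∷ c₂ ∷ xs , _ , ((x≢c₁ ∷ x≢c₂ ∷ x≢xs) ∷ (c₁≢c₂ ∷ c₁≢xs) ∷ u) , ch) =
      unrolled-cycle-impossible x c₁ c₂ xs
        (Chain-snoc T (x ∷ c₁ ∷ c₂ ∷ xs) ch (proj₁ ch))
        (x≢c₂ , unrolled-nonBacktracking x c₁ c₁ c₂ xs ((c₁≢c₂ ∷ c₁≢xs) ∷ u) (λ e → x≢c₁ (sym e))
                  (x≢c₂ ∷ x≢xs) (c₁≢c₂ ∷ c₁≢xs))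

Avoiding : ∀ {n} → SimpleGraph n → Fin n → Fin n → Fin n → Set
Avoiding G v₀ a b = Edge (adj G) a b × a ≢ v₀ × b ≢ v₀

module SearchOrder {n : ℕ} (G : SimpleGraph n) (connected : Connected (adj G)) (r : Fin n) where

  record Searched (S : VertexSet n) : Set where
    field
      rank       : Fin n → ℕ
      last       : Fin n
      root∈S     : S r ≡ true
      last∈S     : S last ≡ true
      rank-root  : rank r ≡ 0
      last-top   : ∀ x → S x ≡ true → x ≢ last → rank x < rank last
      descent    : ∀ v → S v ≡ true → v ≢ r → ∃[ w ] (Edge (adj G) v w × S w ≡ true × rank w < rank v)

    rank≤last : ∀ x → S x ≡ true → rank x ≤ rank last
    rank≤last x x∈S with x ≟ last
    ... | yes refl = ≤-refl
    ... | no x≢last = <⇒≤ (last-top x x∈S x≢last)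

  start : Searched ⁅ r ⁆
  start = record
    { rank = λ _ → 0 ; last = r ; root∈S = r∈ ; last∈S = r∈ ; rank-root = refl
    ; last-top = λ x x∈ x≢r → ⊥-elim (≡true⇒≢false x∈ (update-other _ true x≢r))
    ; descent = λ v v∈ v≢r → ⊥-elim (≡true⇒≢false v∈ (update-other _ true v≢r)) }
    where
    r∈ : ⁅ r ⁆ r ≡ true
    r∈ = update-here _ r true

  extend : ∀ S → Searched S → ∀ v → S v ≡ false → ∃[ S′ ] (Searched S′ × S ⊂ᵇ S′)
  extend S P v v∉S with exit-edge S (connected r v) (Searched.root∈S P) v∉S
  ... | x , y , xy , x∈S , y∉S = update S y true , P′ , sub , y , y∉S , update-here S y true
    where
    open Searched P
    S′ : VertexSet n
    S′ = update S y true
    rank′ : Fin n → ℕ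
    rank′ = update rank y (suc (rank last))
    old : ∀ {a} → S a ≡ true → a ≢ y
    old a∈S refl = ≡true⇒≢false a∈S y∉S
    sub : S ⊆ᵇ S′
    sub a a∈S = trans (update-other S true (old a∈S)) a∈S
    was-in : ∀ {a} → S′ a ≡ true → a ≢ y → S a ≡ true
    was-in a∈ a≢y = trans (sym (update-other S true a≢y)) a∈
    rank′-old : ∀ {a} → a ≢ y → rank′ a ≡ rank a
    rank′-old = update-other rank (suc (rank last))
    below-y : ∀ {a} → S a ≡ true → rank′ a < rank′ y
    below-y {a} a∈S rewrite rank′-old (old a∈S) | update-here rank y (suc (rank last)) =
      s≤s (rank≤last a a∈S)
    P′ : Searched S′
    P′ = record
      { rank = rank′ ; last = y ; root∈S = sub r root∈S ; last∈S = update-here S y true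
      ; rank-root = trans (rank′-old (old root∈S)) rank-root
      ; last-top = λ a a∈ a≢y → below-y (was-in a∈ a≢y)
      ; descent = descent′ }
      where
      descent′ : ∀ a → S′ a ≡ true → a ≢ r → ∃[ w ] (Edge (adj G) a w × S′ w ≡ true × rank′ w < rank′ a)
      descent′ a a∈ a≢r with a ≟ y
      ... | yes refl = x , Edge-sym (SimpleGraph.sym G) xy , sub x x∈S ,
        subst (rank′ x <_) (update-here rank y (suc (rank last))) (below-y x∈S)
      ... | no a≢y with descent a a∈ a≢r
      ...   | w , aw , w∈S , lt =
        w , aw , sub w w∈S , subst (_< rank a) (sym (rank′-old (old w∈S))) lt

  module _ {S : VertexSet n} (P : Searched S) (full : ∀ v → S v ≡ true) where
    open Searched P

    descend : ∀ m x → rank x ≤ m → x ≢ last → Star (Avoiding G last) x r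
    descend m x _ x≢last with x ≟ r
    ... | yes refl = ε
    descend m x x≤m x≢last | no x≢r with descent x (full x) x≢r
    descend zero x x≤m x≢last | no x≢r | w , xw , _ , w<x with <-≤-trans w<x x≤m
    ... | ()
    descend (suc m) x x≤m x≢last | no x≢r | w , xw , _ , w<x =
      (xw , x≢last , w≢last) ◅ descend m w (≤-pred (<-≤-trans w<x x≤m)) w≢last
      where
      w≢last : w ≢ last
      w≢last refl = <-asym w<x (last-top x (full x) x≢last)

    avoiding-connected : ∀ x y → x ≢ last → y ≢ last → Star (Avoiding G last) x y
    avoiding-connected x y x≢last y≢last =
      descend _ x ≤-refl x≢last ◅◅
      Star-reverse (λ (e , a≢ , b≢) → Edge-sym (SimpleGraph.sym G) e , b≢ , a≢) (descend _ y ≤-refl y≢last)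

    last≢root : ∀ x → x ≢ r → last ≢ r
    last≢root x x≢r last≡r =
      n≮0 (subst (rank x <_) (trans (cong rank last≡r) rank-root)
                 (last-top x (full x) (λ x≡last → x≢r (trans x≡last last≡r))))

  last-is-non-cut : ∀ x → x ≢ r →
    ∃[ v₀ ] ∃[ u₀ ] (Edge (adj G) v₀ u₀ × ∀ x y → x ≢ v₀ → y ≢ v₀ → Star (Avoiding G v₀) x y)
  last-is-non-cut x x≢r with saturate Searched extend ⁅ r ⁆ start
  ... | S , P , full with Searched.descent P (Searched.last P) (full _) (last≢root P full x x≢r)
  ...   | u₀ , e₀ , _ = Searched.last P , u₀ , e₀ , avoiding-connected P full

non-cut-vertex : ∀ {n} (G : SimpleGraph n) → 2 ≤ n → Connected (adj G) →
  ∃[ v₀ ] ∃[ u₀ ] (Edge (adj G) v₀ u₀ × ∀ x y → x ≢ v₀ → y ≢ v₀ → Star (Avoiding G v₀) x y)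
non-cut-vertex {suc zero}    G (s≤s ()) _
non-cut-vertex {suc (suc m)} G _        connected = SearchOrder.last-is-non-cut G connected zero (suc zero) (λ ())

double : ℕ → ℕ
double zero    = 0
double (suc i) = suc (suc (double i))

double-mono : ∀ {i j} → i < j → double i < double j
double-mono {zero}  {suc j} _       = s≤s z≤n
double-mono {suc i} {suc j} (s≤s p) = s≤s (s≤s (double-mono p))

double+1<double : ∀ {i j} → i < j → suc (double i) < double j
double+1<double {zero}  {suc j} _       = s≤s (s≤s z≤n)
double+1<double {suc i} {suc j} (s≤s p) = s≤s (s≤s (double+1<double p))

double≢odd : ∀ i j → double i ≢ suc (double j)
double≢odd (suc i) (suc j) e = double≢odd i j (cong (λ m → Data.Nat.pred (Data.Nat.pred m)) e)
double≢odd (suc zero) zero ()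
double≢odd (suc (suc _)) zero ()

2+k+i≡k+2+i : ∀ k i → suc (suc k) + i ≡ k + suc (suc i)
2+k+i≡k+2+i k i = sym (trans (+-suc k (suc i)) (cong suc (+-suc k i)))

-- The ear z₀ z₁ … z_m p is laid out as z₀, {z₀,z₁}, z₁, …, z_m, {z_m,p} at ranks k, k+1, k+2, …
module EarLayout {n : ℕ} (R : EdgeRel n) (R-sym : ∀ x y → R x y ≡ R y x) (p : Fin n) where

  next : List (Fin n) → Fin n
  next []      = p
  next (y ∷ _) = y

  vrank : Fin n → List (Fin n) → ℕ → Maybe ℕ
  vrank v []       k = nothing
  vrank v (x ∷ xs) k with v ≟ x
  ... | yes _ = just k
  ... | no _  = vrank v xs (suc (suc k))

  erank : Fin n → Fin n → List (Fin n) → ℕ → Maybe ℕ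
  erank a b []       k = nothing
  erank a b (x ∷ xs) k with sameEdge a b x (next xs)
  ... | true  = just (suc k)
  ... | false = erank a b xs (suc (suc k))

  vrank-here : ∀ x xs k → vrank x (x ∷ xs) k ≡ just k
  vrank-here x xs k with x ≟ x
  ... | yes _   = refl
  ... | no x≢x  = ⊥-elim (x≢x refl)

  vrank-there : ∀ {v x} xs k → v ≢ x → vrank v (x ∷ xs) k ≡ vrank v xs (suc (suc k))
  vrank-there {v} {x} xs k v≢x with v ≟ x
  ... | yes v≡x = ⊥-elim (v≢x v≡x)
  ... | no _    = refl

  erank-here : ∀ a b x xs k → sameEdge a b x (next xs) ≡ true → erank a b (x ∷ xs) k ≡ just (suc k)
  erank-here a b x xs k e with sameEdge a b x (next xs)
  erank-here a b x xs k refl | true = refl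

  erank-there : ∀ a b x xs k → sameEdge a b x (next xs) ≡ false →
    erank a b (x ∷ xs) k ≡ erank a b xs (suc (suc k))
  erank-there a b x xs k e with sameEdge a b x (next xs)
  erank-there a b x xs k refl | false = refl

  vrank-∈ : ∀ {v} xs {k r} → vrank v xs k ≡ just r → v ∈ xs
  vrank-∈ {v} (x ∷ xs) h with v ≟ x
  ... | yes v≡x = here v≡x
  ... | no _    = there (vrank-∈ xs h)

  vrank-defined : ∀ {v} xs k → v ∈ xs → ∃[ r ] (vrank v xs k ≡ just r)
  vrank-defined {v} (x ∷ xs) k v∈ with v ≟ x
  ... | yes _ = k , refl
  vrank-defined (x ∷ xs) k (here v≡x)  | no v≢x = ⊥-elim (v≢x v≡x)
  vrank-defined (x ∷ xs) k (there v∈) | no _   = vrank-defined xs (suc (suc k)) v∈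

  vrank-range : ∀ v xs k {r} → vrank v xs k ≡ just r → ∃[ i ] (i < length xs × r ≡ k + double i)
  vrank-range v (x ∷ xs) k h with v ≟ x
  vrank-range v (x ∷ xs) k refl | yes _ = 0 , s≤s z≤n , sym (+-identityʳ k)
  ... | no _ with vrank-range v xs (suc (suc k)) h
  ...   | i , i< , refl = suc i , s≤s i< , 2+k+i≡k+2+i k (double i)

  erank-range : ∀ a b xs k {r} → erank a b xs k ≡ just r → ∃[ i ] (i < length xs × r ≡ k + suc (double i))
  erank-range a b (x ∷ xs) k h with sameEdge a b x (next xs)
  erank-range a b (x ∷ xs) k refl | true = 0 , s≤s z≤n , sym (trans (+-suc k 0) (cong suc (+-identityʳ k)))
  ... | false with erank-range a b xs (suc (suc k)) h
  ...   | i , i< , refl = suc i , s≤s i< , 2+k+i≡k+2+i k (suc (double i))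

  vrank-≥ : ∀ v xs k {r} → vrank v xs k ≡ just r → k ≤ r
  vrank-≥ v xs k h with vrank-range v xs k h
  ... | i , _ , refl = m≤m+n k (double i)

  erank-> : ∀ a b xs k {r} → erank a b xs k ≡ just r → k < r
  erank-> a b xs k h with erank-range a b xs k h
  ... | i , _ , refl = subst (k <_) (sym (+-suc k (double i))) (s≤s (m≤m+n k (double i)))

  vrank-injective : ∀ u v xs k {r} → vrank u xs k ≡ just r → vrank v xs k ≡ just r → u ≡ v
  vrank-injective u v (x ∷ xs) k h₁ h₂ with u ≟ x | v ≟ x
  ... | yes u≡x | yes v≡x = trans u≡x (sym v≡x)
  vrank-injective u v (x ∷ xs) k refl h₂ | yes _ | no _ =
    ⊥-elim (<-irrefl refl (<-≤-trans (n<1+n k) (≤-trans (n≤1+n _) (vrank-≥ v xs _ h₂))))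
  vrank-injective u v (x ∷ xs) k h₁ refl | no _ | yes _ =
    ⊥-elim (<-irrefl refl (<-≤-trans (n<1+n k) (≤-trans (n≤1+n _) (vrank-≥ u xs _ h₁))))
  ... | no _ | no _ = vrank-injective u v xs (suc (suc k)) h₁ h₂

  erank-sym : ∀ a b xs k → erank a b xs k ≡ erank b a xs k
  erank-sym a b []       k = refl
  erank-sym a b (x ∷ xs) k rewrite sameEdge-comm a b x (next xs) with sameEdge b a x (next xs)
  ... | true  = refl
  ... | false = erank-sym a b xs (suc (suc k))

  erank-injective : ∀ a b u v xs k {r} → erank a b xs k ≡ just r → erank u v xs k ≡ just r →
    sameEdge a b u v ≡ true
  erank-injective a b u v (x ∷ xs) k h₁ h₂ with sameEdge a b x (next xs) in e₁ | sameEdge u v x (next xs) in e₂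
  ... | true  | true  = sameEdge-trans {a = a} {b} {u} {v} {x} {next xs} e₁ e₂
  erank-injective a b u v (x ∷ xs) k refl h₂ | true | false =
    ⊥-elim (<-asym (n<1+n _) (erank-> u v xs _ h₂))
  erank-injective a b u v (x ∷ xs) k h₁ refl | false | true =
    ⊥-elim (<-asym (n<1+n _) (erank-> a b xs _ h₁))
  ... | false | false = erank-injective a b u v xs (suc (suc k)) h₁ h₂

  OnEar : Fin n → List (Fin n) → Set
  OnEar v xs = v ∈ xs ⊎ v ≡ p

  OnEar-there : ∀ {v x xs} → OnEar v xs → OnEar v (x ∷ xs)
  OnEar-there (inj₁ v∈) = inj₁ (there v∈)
  OnEar-there (inj₂ v≡p) = inj₂ v≡p

  next-OnEar : ∀ xs → OnEar (next xs) xs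
  next-OnEar []      = inj₂ refl
  next-OnEar (y ∷ _) = inj₁ (here refl)

  head-off-ear : ∀ {x xs} → Unique (x ∷ xs) → x ≢ p → ¬ OnEar x xs
  head-off-ear (x∉xs ∷ _) x≢p (inj₁ x∈xs) = All¬⇒¬Any x∉xs x∈xs
  head-off-ear _          x≢p (inj₂ x≡p)  = x≢p x≡p

  erank-ends : ∀ a b xs k {r} → erank a b xs k ≡ just r → OnEar a xs × OnEar b xs
  erank-ends a b (x ∷ xs) k h with sameEdge a b x (next xs) in e
  ... | true with sameEdge-sound {a = a} {b} e
  ...   | inj₁ (refl , refl) = inj₁ (here refl) , OnEar-there (next-OnEar xs)
  ...   | inj₂ (refl , refl) = OnEar-there (next-OnEar xs) , inj₁ (here refl)
  erank-ends a b (x ∷ xs) k h | false with erank-ends a b xs _ h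
  ...   | a∈ , b∈ = OnEar-there a∈ , OnEar-there b∈

  ear-first-edge : ∀ x xs → Chain R (x ∷ xs ++ p ∷ []) → Edge R x (next xs)
  ear-first-edge x []      (r , _) = r
  ear-first-edge x (_ ∷ _) (r , _) = r

  ear-rest : ∀ x xs → Chain R (x ∷ xs ++ p ∷ []) → Chain R (xs ++ p ∷ [])
  ear-rest x []      _       = tt
  ear-rest x (_ ∷ _) (_ , c) = c

  erank-edge : ∀ a b xs k {r} → Chain R (xs ++ p ∷ []) → erank a b xs k ≡ just r → Edge R a b
  erank-edge a b (x ∷ xs) k c h with sameEdge a b x (next xs) in e
  ... | true with sameEdge-sound {a = a} {b} e
  ...   | inj₁ (refl , refl) = ear-first-edge x xs c
  ...   | inj₂ (refl , refl) = Edge-sym R-sym (ear-first-edge x xs c)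
  erank-edge a b (x ∷ xs) k c h | false = erank-edge a b xs _ (ear-rest x xs c) h

  erank-off-ear : ∀ {x} z xs k → ¬ OnEar x xs → erank x z xs k ≡ nothing
  erank-off-ear {x} z xs k off with erank x z xs k in e
  ... | nothing = refl
  ... | just _  = ⊥-elim (off (proj₁ (erank-ends x z xs k e)))

  erank-head : ∀ x q xs k → ¬ OnEar x xs → q ≢ next xs → erank x q (x ∷ xs) k ≡ nothing
  erank-head x q xs k off q≢next with sameEdge x q x (next xs) in e
  ... | false = erank-off-ear q xs _ off
  ... | true with sameEdge-sound {a = x} {q} e
  ...   | inj₁ (_ , q≡next) = ⊥-elim (q≢next q≡next)
  ...   | inj₂ (x≡next , _) = ⊥-elim (off (subst (λ y → OnEar y xs) (sym x≡next) (next-OnEar xs)))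

  Predecessor : Fin n → List (Fin n) → ℕ → ℕ → Set
  Predecessor v xs k r = ∃₂ λ w r′ → vrank w xs k ≡ just r′ × erank v w xs k ≡ just (suc r′) × r ≡ suc (suc r′)

  vrank-predecessor : ∀ x xs k {v r} → Unique (x ∷ xs) → vrank v (x ∷ xs) k ≡ just r →
    (v ≡ x × r ≡ k) ⊎ Predecessor v (x ∷ xs) k r
  vrank-predecessor x xs k {v} {r} u h = by-cases (v ≟ x)
    where
    by-cases : Dec (v ≡ x) → (v ≡ x × r ≡ k) ⊎ Predecessor v (x ∷ xs) k r
    by-cases (yes refl) = inj₁ (refl , just-injective (trans (sym h) (vrank-here x xs k)))
    by-cases (no v≢x) = later xs u (trans (sym (vrank-there xs k v≢x)) h)
      where
      later : ∀ ys → Unique (x ∷ ys) → vrank v ys (suc (suc k)) ≡ just r → (v ≡ x × r ≡ k) ⊎ Predecessor v (x ∷ ys) k r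
      later (y ∷ ys) (x∉ ∷ u) h′ with vrank-predecessor y ys (suc (suc k)) {v} u h′
      ... | inj₁ (refl , refl) =
        inj₂ (x , k , vrank-here x (v ∷ ys) k , erank-here v x x (v ∷ ys) k (sameEdge-flip v x) , refl)
      ... | inj₂ (w , r′ , wr , vw , refl) =
        inj₂ (w , r′ , trans (vrank-there (y ∷ ys) k w≢x) wr ,
              trans (erank-there v w x (y ∷ ys) k (sameEdge-distinct [ (λ (v≡x , _) → v≢x v≡x) , (λ (_ , w≡x) → w≢x w≡x) ])) vw ,
              refl)
        where
        w≢x : w ≢ x
        w≢x refl = All¬⇒¬Any x∉ (vrank-∈ (y ∷ ys) wr)

  erank-absorbed : ∀ xs k a b {r} → Unique xs → All (_≢ p) xs → erank a b xs k ≡ just r →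
    ∃₂ λ x y → SameEnds x y a b × ∃ λ r₀ → r ≡ suc r₀ × vrank x xs k ≡ just r₀ ×
      (∀ z {r′} → erank x z xs k ≡ just r′ → z ≢ y → r′ < r)
  erank-absorbed (x ∷ xs) k a b u (x≢p ∷ ≢p) h with sameEdge a b x (next xs) in e
  erank-absorbed (x ∷ xs) k a b u (x≢p ∷ ≢p) refl | true =
    x , next xs , ends , k , refl , vrank-here x xs k , only-edge
    where
    ends : SameEnds x (next xs) a b
    ends with sameEdge-sound {a = a} {b} e
    ... | inj₁ (e₁ , e₂) = inj₁ (sym e₁ , sym e₂)
    ... | inj₂ (e₁ , e₂) = inj₂ (sym e₂ , sym e₁)
    only-edge : ∀ z {r′} → erank x z (x ∷ xs) k ≡ just r′ → z ≢ next xs → r′ < suc k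
    only-edge z h z≢next with trans (sym h) (erank-head x z xs k (head-off-ear u x≢p) z≢next)
    ... | ()
  erank-absorbed (x ∷ xs) k a b (x∉ ∷ u) (x≢p ∷ ≢p) h | false with erank-absorbed xs (suc (suc k)) a b u ≢p h
  ... | x′ , y′ , ends , r₀ , refl , x′r , earlier =
    x′ , y′ , ends , r₀ , refl , trans (vrank-there xs k x′≢x) x′r , earlier′
    where
    x′≢x : x′ ≢ x
    x′≢x refl = All¬⇒¬Any x∉ (vrank-∈ xs x′r)
    earlier′ : ∀ z {r′} → erank x′ z (x ∷ xs) k ≡ just r′ → z ≢ y′ → r′ < suc r₀
    earlier′ z h′ z≢y′ with sameEdge x′ z x (next xs)
    earlier′ z refl z≢y′ | true  = <-trans (n<1+n (suc k)) (erank-> a b xs _ h)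
    ...                  | false = earlier z h′ z≢y′

  erank-tail : ∀ {a b} x xs k {r} → erank a b xs (suc (suc k)) ≡ just r → ∃[ r′ ] (erank a b (x ∷ xs) k ≡ just r′)
  erank-tail {a} {b} x xs k h with sameEdge a b x (next xs)
  ... | true  = _ , refl
  ... | false = _ , h

  ear-reaches-end : ∀ {Q : Fin n → Fin n → Set} xs k → (∀ a b {r} → erank a b xs k ≡ just r → Q a b) →
    ∀ {v} → OnEar v xs → Star Q v p
  ear-reaches-end xs k new (inj₂ refl) = ε
  ear-reaches-end (x ∷ xs) k new (inj₁ (here refl)) =
    new x (next xs) (erank-here x (next xs) x xs k (sameEdge-refl x (next xs))) ◅
    ear-reaches-end xs (suc (suc k)) (λ a b h → new a b (proj₂ (erank-tail x xs k h))) (next-OnEar xs)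
  ear-reaches-end (x ∷ xs) k new (inj₁ (there v∈)) =
    ear-reaches-end xs (suc (suc k)) (λ a b h → new a b (proj₂ (erank-tail x xs k h))) (inj₁ v∈)

module Shift (K L : ℕ) where

  shift : ℕ → ℕ
  shift r with r <? K
  ... | yes _ = r
  ... | no _  = r + L

  InGap : ℕ → Set
  InGap r = K ≤ r × r < K + L

  shift-below : ∀ {r} → r < K → shift r ≡ r
  shift-below {r} r<K with r <? K
  ... | yes _   = refl
  ... | no r≮K  = ⊥-elim (r≮K r<K)

  shift-above : ∀ {r} → K ≤ r → shift r ≡ r + L
  shift-above {r} K≤r with r <? K
  ... | yes r<K = ⊥-elim (<-irrefl refl (<-≤-trans r<K K≤r))
  ... | no _    = refl

  shift-≥ : ∀ r → r ≤ shift r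
  shift-≥ r with r <? K
  ... | yes _ = ≤-refl
  ... | no _  = m≤m+n r L

  shift-mono : ∀ {a b} → a < b → shift a < shift b
  shift-mono {a} {b} a<b with a <? K | b <? K
  ... | yes _   | yes _   = a<b
  ... | yes a<K | no b≮K  = <-≤-trans a<K (≤-trans (≮⇒≥ b≮K) (m≤m+n b L))
  ... | no a≮K  | yes b<K = ⊥-elim (a≮K (<-trans a<b b<K))
  ... | no _    | no _    = +-monoˡ-< L a<b

  shift-injective : ∀ {a b} → shift a ≡ shift b → a ≡ b
  shift-injective {a} {b} e with <-cmp a b
  ... | tri< a<b _ _ = ⊥-elim (<-irrefl e (shift-mono a<b))
  ... | tri≈ _ a≡b _ = a≡b
  ... | tri> _ _ b<a = ⊥-elim (<-irrefl (sym e) (shift-mono b<a))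

  shift-avoids-gap : ∀ r → ¬ InGap (shift r)
  shift-avoids-gap r (K≤ , <K+L) with r <? K
  ... | yes r<K = <-irrefl refl (<-≤-trans r<K K≤)
  ... | no r≮K  = <-irrefl refl (<-≤-trans <K+L (+-monoˡ-≤ L (≮⇒≥ r≮K)))

module Growth {n : ℕ} (G : SimpleGraph n) (v₀ u₀ : Fin n) where

  Absorbs : EdgeRel n → (Fin n → ℕ) → (Fin n → Fin n → ℕ) → Fin n → Fin n → Fin n → Fin n → Set
  Absorbs T vr er a b x y = vr x < er a b × (∀ z → Edge (adj G) x z → z ≢ y → T x z ≡ false ⊎ er x z < er a b)

  record AbsorbingTree (S : VertexSet n) : Set where
    field
      T         : EdgeRel n
      vr        : Fin n → ℕ
      er        : Fin n → Fin n → ℕ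
      T-sym     : ∀ u v → T u v ≡ T v u
      T⊆G       : ∀ u v → Edge T u v → Edge (adj G) u v
      T⊆S       : ∀ u v → Edge T u v → S u ≡ true
      v₀∈S      : S v₀ ≡ true
      e₀∈T      : Edge T v₀ u₀
      e₀-only   : ∀ w → Edge T v₀ w → w ≡ u₀
      er-sym    : ∀ u v → er u v ≡ er v u
      vr-v₀     : vr v₀ ≡ 0
      er-e₀     : er v₀ u₀ ≡ 1
      vr-late   : ∀ v → S v ≡ true → v ≢ v₀ → 1 < vr v
      er-late   : ∀ a b → Edge T a b → sameEdge a b v₀ u₀ ≡ false → 1 < er a b
      vr-inj    : ∀ u v → S u ≡ true → S v ≡ true → vr u ≡ vr v → u ≡ v
      er-inj    : ∀ a b u v → Edge T a b → Edge T u v → er a b ≡ er u v → sameEdge a b u v ≡ true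
      ve-dis    : ∀ w u v → S w ≡ true → Edge T u v → vr w ≢ er u v
      reachable : ∀ v → S v ≡ true → v ≢ v₀ →
                  ∃[ w ] (Edge (adj G) v w × S w ≡ true × vr w < vr v × (T v w ≡ false ⊎ er v w < vr v))
      absorbed  : ∀ a b → Edge T a b → sameEdge a b v₀ u₀ ≡ false →
                  Absorbs T vr er a b a b ⊎ Absorbs T vr er a b b a
      T-reaches : ∀ v → S v ≡ true → Star (Edge T) v v₀

  -- not-backedge excludes the ear start z₀ start, which would use the edge {start,z₀} twice.
  record Ear (S : VertexSet n) : Set where
    field
      start end first : Fin n
      rest          : List (Fin n)
      start∈S       : S start ≡ true
      end∈S         : S end ≡ true
      unique        : Unique (first ∷ rest)
      outside       : All (λ v → S v ≡ false) (first ∷ rest)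
      path          : Chain (adj G) (start ∷ (first ∷ rest) ++ end ∷ [])
      not-backedge  : start ≡ end → rest ≢ []

  -- The ear is placed right after its start, in a gap opened by shifting all later ranks.
  -- Its edges other than {start,z₀} join T, each absorbed by its first end.
  module Attach (S : VertexSet n) (A : AbsorbingTree S) (ear : Ear S)
    (end≢v₀ : Ear.end ear ≢ v₀) (start≤end : AbsorbingTree.vr A (Ear.start ear) ≤ AbsorbingTree.vr A (Ear.end ear)) where
    open AbsorbingTree A
    open Ear ear
    open EarLayout (adj G) (SimpleGraph.sym G) end

    Z : List (Fin n)
    Z = first ∷ rest

    K : ℕ
    K = 2 ⊔ suc (vr start)

    open Shift K (double (length Z))

    2≤K : 2 ≤ K
    2≤K = m≤m⊔n 2 (suc (vr start))

    start<K : vr start < K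
    start<K = m≤n⊔m 2 (suc (vr start))

    new-vertex-in-gap : ∀ v {r} → vrank v Z K ≡ just r → InGap r
    new-vertex-in-gap v h with vrank-range v Z K h
    ... | i , i< , refl = m≤m+n K (double i) , +-monoʳ-< K (double-mono i<)

    new-edge-in-gap : ∀ a b {r} → erank a b Z K ≡ just r → InGap r × K < r
    new-edge-in-gap a b h with erank-range a b Z K h
    ... | i , i< , refl =
      (m≤m+n K (suc (double i)) , +-monoʳ-< K (double+1<double i<)) , erank-> a b Z K h

    S′ : VertexSet n
    S′ v = S v ∨ is-just (vrank v Z K)

    T′ : EdgeRel n
    T′ a b = T a b ∨ is-just (erank a b Z K)

    vr′ : Fin n → ℕ
    vr′ v = if S v then shift (vr v) else fromMaybe 0 (vrank v Z K)

    er′ : Fin n → Fin n → ℕ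
    er′ a b = if T a b then shift (er a b) else fromMaybe 0 (erank a b Z K)

    S′-old : ∀ {v} → S v ≡ true → S′ v ≡ true
    S′-old e rewrite e = refl

    S′-new : ∀ {v r} → vrank v Z K ≡ just r → S′ v ≡ true
    S′-new {v} e rewrite e = ∨-zeroʳ (S v)

    T′-old : ∀ {a b} → Edge T a b → Edge T′ a b
    T′-old e rewrite e = refl

    T′-new : ∀ {a b r} → erank a b Z K ≡ just r → Edge T′ a b
    T′-new {a} {b} e rewrite e = ∨-zeroʳ (T a b)

    T′-absent : ∀ {a b} → T a b ≡ false → erank a b Z K ≡ nothing → T′ a b ≡ false
    T′-absent e₁ e₂ rewrite e₁ | e₂ = refl

    vr′-old : ∀ {v} → S v ≡ true → vr′ v ≡ shift (vr v)
    vr′-old e rewrite e = refl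

    vr′-new : ∀ {v r} → S v ≡ false → vrank v Z K ≡ just r → vr′ v ≡ r
    vr′-new e₁ e₂ rewrite e₁ | e₂ = refl

    er′-old : ∀ {a b} → Edge T a b → er′ a b ≡ shift (er a b)
    er′-old e rewrite e = refl

    er′-new : ∀ {a b r} → T a b ≡ false → erank a b Z K ≡ just r → er′ a b ≡ r
    er′-new e₁ e₂ rewrite e₁ | e₂ = refl

    S′-cases : ∀ v → S′ v ≡ true → S v ≡ true ⊎ (S v ≡ false × ∃[ r ] (vrank v Z K ≡ just r))
    S′-cases v h with S v | vrank v Z K
    ... | true  | _       = inj₁ refl
    ... | false | just r  = inj₂ (refl , r , refl)

    T′-cases : ∀ a b → Edge T′ a b → Edge T a b ⊎ (T a b ≡ false × ∃[ r ] (erank a b Z K ≡ just r))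
    T′-cases a b h with T a b | erank a b Z K
    ... | true  | _      = inj₁ refl
    ... | false | just r = inj₂ (refl , r , refl)

    on-ear-outside : ∀ {v} → v ∈ Z → S v ≡ false
    on-ear-outside v∈ = lookup outside v∈

    ear-avoids-end : All (_≢ end) Z
    ear-avoids-end = All-map (λ v∉S v≡end → ≡true⇒≢false end∈S (subst (λ x → S x ≡ false) v≡end v∉S)) outside

    new-edge-at-S : ∀ {a b r} → S a ≡ true → erank a b Z K ≡ just r → a ≡ end
    new-edge-at-S {a} {b} a∈S h with proj₁ (erank-ends a b Z K h)
    ... | inj₂ a≡end = a≡end
    ... | inj₁ a∈Z   = ⊥-elim (≡true⇒≢false a∈S (on-ear-outside a∈Z))

    no-new-edge-in-S : ∀ {a b} → S a ≡ true → S b ≡ true → erank a b Z K ≡ nothing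
    no-new-edge-in-S {a} {b} a∈S b∈S with erank a b Z K in h
    ... | nothing = refl
    ... | just r with new-edge-at-S a∈S h | new-edge-at-S {b} {a} b∈S (trans (erank-sym b a Z K) h)
    ...   | refl | refl = ⊥-elim (≡true⇒≢false (erank-edge a a Z K (proj₂ path) h) (SimpleGraph.irrefl G a))

    T-outside : ∀ {a b} → S a ≡ false → T a b ≡ false
    T-outside {a} {b} a∉S with T a b in e
    ... | false = refl
    ... | true  = ⊥-elim (≡true⇒≢false (T⊆S a b e) a∉S)

    T′-sym : ∀ a b → T′ a b ≡ T′ b a
    T′-sym a b = cong₂ _∨_ (T-sym a b) (cong is-just (erank-sym a b Z K))

    T′⊆G : ∀ a b → Edge T′ a b → Edge (adj G) a b
    T′⊆G a b h with T′-cases a b h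
    ... | inj₁ e             = T⊆G a b e
    ... | inj₂ (_ , r , e)   = erank-edge a b Z K (proj₂ path) e

    T′⊆S′ : ∀ a b → Edge T′ a b → S′ a ≡ true
    T′⊆S′ a b h with T′-cases a b h
    ... | inj₁ e = S′-old (T⊆S a b e)
    ... | inj₂ (_ , r , e) with proj₁ (erank-ends a b Z K e)
    ...   | inj₁ a∈Z  = S′-new (proj₂ (vrank-defined Z K a∈Z))
    ...   | inj₂ refl = S′-old end∈S

    e₀-only′ : ∀ w → Edge T′ v₀ w → w ≡ u₀
    e₀-only′ w h with T′-cases v₀ w h
    ... | inj₁ e           = e₀-only w e
    ... | inj₂ (_ , r , e) = ⊥-elim (end≢v₀ (sym (new-edge-at-S v₀∈S e)))

    er′-sym : ∀ a b → er′ a b ≡ er′ b a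
    er′-sym a b rewrite T-sym a b | er-sym a b | erank-sym a b Z K = refl

    vr′-v₀ : vr′ v₀ ≡ 0
    vr′-v₀ rewrite vr′-old v₀∈S | vr-v₀ = shift-below (≤-trans (s≤s z≤n) 2≤K)

    er′-e₀ : er′ v₀ u₀ ≡ 1
    er′-e₀ rewrite er′-old e₀∈T | er-e₀ = shift-below 2≤K

    vr′-late : ∀ v → S′ v ≡ true → v ≢ v₀ → 1 < vr′ v
    vr′-late v h v≢v₀ with S′-cases v h
    ... | inj₁ e rewrite vr′-old e = <-≤-trans (vr-late v e v≢v₀) (shift-≥ _)
    ... | inj₂ (v∉S , r , e) rewrite vr′-new v∉S e = <-≤-trans 2≤K (proj₁ (new-vertex-in-gap v e))

    er′-late : ∀ a b → Edge T′ a b → sameEdge a b v₀ u₀ ≡ false → 1 < er′ a b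
    er′-late a b h ≢e₀ with T′-cases a b h
    ... | inj₁ e rewrite er′-old e = <-≤-trans (er-late a b e ≢e₀) (shift-≥ _)
    ... | inj₂ (ab∉T , r , e) rewrite er′-new ab∉T e = ≤-trans 2≤K (<⇒≤ (proj₂ (new-edge-in-gap a b e)))

    vr′-inj : ∀ u v → S′ u ≡ true → S′ v ≡ true → vr′ u ≡ vr′ v → u ≡ v
    vr′-inj u v hu hv eq with S′-cases u hu | S′-cases v hv
    ... | inj₁ u∈ | inj₁ v∈ rewrite vr′-old u∈ | vr′-old v∈ = vr-inj u v u∈ v∈ (shift-injective eq)
    ... | inj₁ u∈ | inj₂ (v∉ , r , e) rewrite vr′-old u∈ | vr′-new v∉ e =
      ⊥-elim (shift-avoids-gap (vr u) (subst InGap (sym eq) (new-vertex-in-gap v e)))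
    ... | inj₂ (u∉ , r , e) | inj₁ v∈ rewrite vr′-new u∉ e | vr′-old v∈ =
      ⊥-elim (shift-avoids-gap (vr v) (subst InGap eq (new-vertex-in-gap u e)))
    ... | inj₂ (u∉ , r , e) | inj₂ (v∉ , r′ , e′) rewrite vr′-new u∉ e | vr′-new v∉ e′ =
      vrank-injective u v Z K e (trans e′ (cong just (sym eq)))

    er′-inj : ∀ a b u v → Edge T′ a b → Edge T′ u v → er′ a b ≡ er′ u v → sameEdge a b u v ≡ true
    er′-inj a b u v hab huv eq with T′-cases a b hab | T′-cases u v huv
    ... | inj₁ ab∈ | inj₁ uv∈ rewrite er′-old ab∈ | er′-old uv∈ = er-inj a b u v ab∈ uv∈ (shift-injective eq)
    ... | inj₁ ab∈ | inj₂ (uv∉ , r , e) rewrite er′-old ab∈ | er′-new uv∉ e =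
      ⊥-elim (shift-avoids-gap (er a b) (subst InGap (sym eq) (proj₁ (new-edge-in-gap u v e))))
    ... | inj₂ (ab∉ , r , e) | inj₁ uv∈ rewrite er′-new ab∉ e | er′-old uv∈ =
      ⊥-elim (shift-avoids-gap (er u v) (subst InGap eq (proj₁ (new-edge-in-gap a b e))))
    ... | inj₂ (ab∉ , r , e) | inj₂ (uv∉ , r′ , e′) rewrite er′-new ab∉ e | er′-new uv∉ e′ =
      erank-injective a b u v Z K e (trans e′ (cong just (sym eq)))

    ve′-dis : ∀ w a b → S′ w ≡ true → Edge T′ a b → vr′ w ≢ er′ a b
    ve′-dis w a b hw hab eq with S′-cases w hw | T′-cases a b hab
    ... | inj₁ w∈ | inj₁ ab∈ rewrite vr′-old w∈ | er′-old ab∈ = ve-dis w a b w∈ ab∈ (shift-injective eq)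
    ... | inj₁ w∈ | inj₂ (ab∉ , r , e) rewrite vr′-old w∈ | er′-new ab∉ e =
      shift-avoids-gap (vr w) (subst InGap (sym eq) (proj₁ (new-edge-in-gap a b e)))
    ... | inj₂ (w∉ , r , e) | inj₁ ab∈ rewrite vr′-new w∉ e | er′-old ab∈ =
      shift-avoids-gap (er a b) (subst InGap eq (new-vertex-in-gap w e))
    ... | inj₂ (w∉ , r , e) | inj₂ (ab∉ , r′ , e′) rewrite vr′-new w∉ e | er′-new ab∉ e′
      with vrank-range w Z K e | erank-range a b Z K e′
    ...   | i , _ , refl | j , _ , refl = double≢odd i j (+-cancelˡ-≡ K _ _ eq)

    reachable′ : ∀ v → S′ v ≡ true → v ≢ v₀ →
      ∃[ w ] (Edge (adj G) v w × S′ w ≡ true × vr′ w < vr′ v × (T′ v w ≡ false ⊎ er′ v w < vr′ v))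
    reachable′ v h v≢v₀ with S′-cases v h
    ... | inj₁ v∈ with reachable v v∈ v≢v₀
    ...   | w , vw , w∈ , w<v , via = w , vw , S′-old w∈ , below , via′ (T v w) refl via
      where
      below : vr′ w < vr′ v
      below rewrite vr′-old w∈ | vr′-old v∈ = shift-mono w<v
      via′ : ∀ t → T v w ≡ t → T v w ≡ false ⊎ er v w < vr v → T′ v w ≡ false ⊎ er′ v w < vr′ v
      via′ false vw∉ _           = inj₁ (T′-absent vw∉ (no-new-edge-in-S v∈ w∈))
      via′ true  vw∈ (inj₁ vw∉)  = ⊥-elim (≡true⇒≢false vw∈ vw∉)
      via′ true  vw∈ (inj₂ e<v)  = inj₂ (subst₂ _<_ (sym (er′-old vw∈)) (sym (vr′-old v∈)) (shift-mono e<v))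
    reachable′ v h v≢v₀ | inj₂ (v∉ , r , e) with vrank-predecessor first rest K {v} unique e
    ... | inj₁ (refl , refl) =
      start , Edge-sym (SimpleGraph.sym G) (proj₁ path) , S′-old start∈S , below , inj₁ (T′-absent (T-outside v∉) not-new)
      where
      below : vr′ start < vr′ v
      below rewrite vr′-old start∈S | vr′-new v∉ e | shift-below start<K = start<K
      start≢next : ∀ {ys} → ys ≡ rest → start ≢ next ys
      start≢next {[]}    []≡rest start≡end = not-backedge start≡end (sym []≡rest)
      start≢next {y ∷ _} ys≡rest start≡y   =
        ≡true⇒≢false start∈S (on-ear-outside (there (subst (start ∈_) ys≡rest (here start≡y))))
      not-new : erank v start Z K ≡ nothing
      not-new = erank-head v start rest K (head-off-ear unique (All-head ear-avoids-end)) (start≢next refl)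
    ... | inj₂ (w , r′ , wr , vw , refl) =
      w , erank-edge v w Z K (proj₂ path) vw , S′-new wr ,
      subst₂ _<_ (sym (vr′-new (lookup outside (vrank-∈ Z wr)) wr)) (sym (vr′-new v∉ e)) (s≤s (n≤1+n r′)) ,
      inj₂ (subst₂ _<_ (sym (er′-new (T-outside v∉) vw)) (sym (vr′-new v∉ e)) ≤-refl)

    absorption-kept : ∀ {a b} → Edge T a b → sameEdge a b v₀ u₀ ≡ false → ∀ {x y} → S x ≡ true →
      Absorbs T vr er a b x y → Absorbs T′ vr′ er′ a b x y
    absorption-kept {a} {b} ab∈T ≢e₀ {x} {y} x∈S (x<ab , last) = below , last′
      where
      below : vr′ x < er′ a b
      below rewrite vr′-old x∈S | er′-old ab∈T = shift-mono x<ab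
      last′ : ∀ z → Edge (adj G) x z → z ≢ y → T′ x z ≡ false ⊎ er′ x z < er′ a b
      last′ z xz z≢y = cases (erank x z Z K) refl (T x z) refl
        where
        cases : ∀ m → erank x z Z K ≡ m → ∀ t → T x z ≡ t → T′ x z ≡ false ⊎ er′ x z < er′ a b
        cases nothing new false old = inj₁ (T′-absent old new)
        cases nothing new true  old with last z xz z≢y
        ... | inj₁ xz∉T = ⊥-elim (≡true⇒≢false old xz∉T)
        ... | inj₂ xz<ab = inj₂ (subst₂ _<_ (sym (er′-old old)) (sym (er′-old ab∈T)) (shift-mono xz<ab))
        cases (just r) new true old with trans (sym (no-new-edge-in-S x∈S (T⊆S z x (trans (T-sym z x) old)))) new
        ... | ()
        -- Then x is the end of the ear, and vr start ≤ vr end < er a b puts {a,b} above the gap.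
        cases (just r) new false old =
          inj₂ (subst₂ _<_ (sym (er′-new old new)) (sym (er′-old ab∈T))
                 (<-≤-trans (proj₂ (proj₁ (new-edge-in-gap x z new))) gap-below-ab))
          where
          K≤ab : K ≤ er a b
          K≤ab = ⊔-lub (er-late a b ab∈T ≢e₀)
                   (≤-<-trans (subst (λ e → vr start ≤ vr e) (sym (new-edge-at-S x∈S new)) start≤end) x<ab)
          gap-below-ab : K + double (length Z) ≤ shift (er a b)
          gap-below-ab = subst (K + double (length Z) ≤_) (sym (shift-above K≤ab)) (+-monoˡ-≤ _ K≤ab)

    new-edge-absorbed : ∀ {a b r} → T a b ≡ false → erank a b Z K ≡ just r →
      Absorbs T′ vr′ er′ a b a b ⊎ Absorbs T′ vr′ er′ a b b a
    new-edge-absorbed {a} {b} ab∉T e with erank-absorbed Z K a b unique ear-avoids-end e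
    ... | x , y , ends , r₀ , refl , xr , only-edge = orient ends
      where
      x∉S : S x ≡ false
      x∉S = lookup outside (vrank-∈ {x} Z xr)
      absorbs : Absorbs T′ vr′ er′ a b x y
      absorbs = below , last′
        where
        below : vr′ x < er′ a b
        below rewrite vr′-new x∉S xr | er′-new ab∉T e = ≤-refl
        last′ : ∀ z → Edge (adj G) x z → z ≢ y → T′ x z ≡ false ⊎ er′ x z < er′ a b
        last′ z xz z≢y = cases (erank x z Z K) refl
          where
          cases : ∀ m → erank x z Z K ≡ m → T′ x z ≡ false ⊎ er′ x z < er′ a b
          cases nothing   new = inj₁ (T′-absent (T-outside x∉S) new)
          cases (just r′) new =
            inj₂ (subst₂ _<_ (sym (er′-new (T-outside x∉S) new)) (sym (er′-new ab∉T e)) (only-edge z new z≢y))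
      orient : SameEnds x y a b → Absorbs T′ vr′ er′ a b a b ⊎ Absorbs T′ vr′ er′ a b b a
      orient (inj₁ (refl , refl)) = inj₁ absorbs
      orient (inj₂ (refl , refl)) = inj₂ absorbs

    absorbed′ : ∀ a b → Edge T′ a b → sameEdge a b v₀ u₀ ≡ false →
      Absorbs T′ vr′ er′ a b a b ⊎ Absorbs T′ vr′ er′ a b b a
    absorbed′ a b h ≢e₀ with T′-cases a b h
    ... | inj₁ ab∈T = Data.Sum.map (absorption-kept ab∈T ≢e₀ (T⊆S a b ab∈T))
                                   (absorption-kept ab∈T ≢e₀ (T⊆S b a (trans (T-sym b a) ab∈T)))
                                   (absorbed a b ab∈T ≢e₀)
    ... | inj₂ (ab∉T , r , e) = new-edge-absorbed ab∉T e

    T′-reaches : ∀ v → S′ v ≡ true → Star (Edge T′) v v₀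
    T′-reaches v h with S′-cases v h
    ... | inj₁ v∈S = Star-map T′-old (T-reaches v v∈S)
    ... | inj₂ (_ , r , e) =
      ear-reaches-end Z K (λ a b → T′-new) (inj₁ (vrank-∈ Z e)) ◅◅ Star-map T′-old (T-reaches end end∈S)

    extended : AbsorbingTree S′
    extended = record
      { T = T′ ; vr = vr′ ; er = er′
      ; T-sym = T′-sym ; T⊆G = T′⊆G ; T⊆S = T′⊆S′ ; v₀∈S = S′-old v₀∈S ; e₀∈T = T′-old e₀∈T ; e₀-only = e₀-only′
      ; er-sym = er′-sym ; vr-v₀ = vr′-v₀ ; er-e₀ = er′-e₀ ; vr-late = vr′-late ; er-late = er′-late
      ; vr-inj = vr′-inj ; er-inj = er′-inj ; ve-dis = ve′-dis
      ; reachable = reachable′ ; absorbed = absorbed′ ; T-reaches = T′-reaches }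

    attached : ∃[ S′ ] (AbsorbingTree S′ × S ⊂ᵇ S′)
    attached = S′ , extended , (λ v → S′-old) , first , All-head outside , S′-new (vrank-here first rest K)

  module _ {S : VertexSet n} (A : AbsorbingTree S) (full : ∀ v → S v ≡ true) where
    open AbsorbingTree A
    open Absorption T er er-sym T-sym using (LastAt; absorbed⇒acyclic)

    absorbs⇒last-at : ∀ {a b x y} → Absorbs T vr er a b x y → er x y ≡ er a b → LastAt x y
    absorbs⇒last-at {x = x} (_ , last) same z xz z≢y with last z (T⊆G _ _ xz) z≢y
    ... | inj₁ xz∉T = ⊥-elim (≡true⇒≢false xz xz∉T)
    ... | inj₂ xz<ab = subst (er x z <_) (sym same) xz<ab

    last-at-absorber : ∀ a b → Edge T a b → LastAt a b ⊎ LastAt b a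
    last-at-absorber a b ab with sameEdge a b v₀ u₀ in ≟e₀
    ... | false = Data.Sum.map (λ abs → absorbs⇒last-at abs refl) (λ abs → absorbs⇒last-at abs (er-sym b a))
                               (absorbed a b ab ≟e₀)
    ... | true with sameEdge-sound {a = a} {b} ≟e₀
    ...   | inj₁ (refl , refl) = inj₁ λ z v₀z z≢u₀ → ⊥-elim (z≢u₀ (e₀-only z v₀z))
    ...   | inj₂ (refl , refl) = inj₂ λ z v₀z z≢u₀ → ⊥-elim (z≢u₀ (e₀-only z v₀z))

    is-spanning-tree : IsSpanningTree G T
    is-spanning-tree = T-sym , T⊆G , connected , absorbed⇒acyclic last-at-absorber
      where
      connected : Connected T
      connected u v = T-reaches u (full u) ◅◅ Star-reverse (Edge-sym T-sym) (T-reaches v (full v))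

    has-absorption-order : HasAbsorptionOrder G T
    has-absorption-order =
      order , v₀ , u₀ , e₀∈T , e₀-only ,
      subst₂ _<_ (sym vr-v₀) (sym er-e₀) (s≤s z≤n) ,
      (λ w w≢v₀ → subst (_< vr w) (sym er-e₀) (vr-late w (full w) w≢v₀)) ,
      (λ a b ab ≢e₀ → subst (_< er a b) (sym er-e₀) (er-late a b ab ≢e₀)) ,
      (λ v v≢v₀ → let (w , vw , _ , w<v , via) = reachable v (full v) v≢v₀ in w , vw , w<v , via) ,
      absorbed
      where
      order : LinearOrderVT T
      order = record
        { vr = vr ; er = er ; er-sym = er-sym
        ; vr-inj = λ u v → vr-inj u v (full u) (full v)
        ; er-inj = er-inj
        ; ve-dis = λ w u v → ve-dis w u v (full w) }

  reverse-ear : ∀ {S} → Ear S → Ear S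
  reverse-ear {S} ear = record
    { start = end ; end = start ; first = first′ ; rest = rest′
    ; start∈S = end∈S ; end∈S = start∈S
    ; unique = subst Unique flipped (Unique-ʳ++ unique [] (universal (λ _ → []) _))
    ; outside = subst (All (λ v → S v ≡ false)) flipped (All-ʳ++ outside [])
    ; path = subst (Chain (adj G)) reversed-path
               (Chain-ʳ++ (SimpleGraph.sym G) start ((first ∷ rest) ++ end ∷ []) path tt)
    ; not-backedge = λ end≡start rest′≡[] → not-backedge (sym end≡start) (ʳ++-singleton rest flipped rest′≡[]) }
    where
    open Ear ear
    nonempty = ʳ++-nonempty rest first []
    first′ = proj₁ nonempty
    rest′ = proj₁ (proj₂ nonempty)
    flipped : rest ʳ++ (first ∷ []) ≡ first′ ∷ rest′
    flipped = proj₂ (proj₂ nonempty)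
    reversed-path : ((first ∷ rest) ++ end ∷ []) ʳ++ (start ∷ []) ≡ end ∷ (first′ ∷ rest′) ++ start ∷ []
    reversed-path = trans (++-ʳ++ (first ∷ rest)) (cong (end ∷_) (trans (ʳ++-∷ʳ (first ∷ rest)) (cong (_∷ʳ start) flipped)))

  open DecMembership (_≟_ {n}) using (_∈?_)

  -- Walk from y₁ in G minus {s,y₁}, keeping the loop-erased path back to y₁, until S is re-entered.
  module _ {S : VertexSet n} (s y₁ : Fin n) (s∈S : S s ≡ true) where

    search : ∀ h Qt → Unique (h ∷ Qt) → All (λ v → S v ≡ false) (h ∷ Qt) → Chain (adj G) (h ∷ Qt ++ s ∷ []) →
      ∃[ pre ] (h ∷ Qt ≡ pre ∷ʳ y₁) → ∀ {u} → S u ≡ true → Star (Edge (deleteEdge (adj G) s y₁)) h u →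
      Σ (Ear S) λ ear → Ear.end ear ≡ s
    search h Qt u (h∉S ∷ _) c _ u∈S ε = ⊥-elim (≡true⇒≢false u∈S h∉S)
    search h Qt u out c (pre , ends) u∈S (_◅_ {j = w} hw walk) with deleted-edge (adj G) s y₁ h w hw | S w in w∈S
    ... | hw∈G , hw≢sy₁ | true = record
      { start = w ; end = s ; first = h ; rest = Qt ; start∈S = w∈S ; end∈S = s∈S
      ; unique = u ; outside = out ; path = Edge-sym (SimpleGraph.sym G) hw∈G , c
      ; not-backedge = not-backedge } , refl
      where
      not-backedge : w ≡ s → Qt ≢ []
      not-backedge w≡s Qt≡[] = ≡true⇒≢false
        (subst₂ (λ x y → sameEdge x y s y₁ ≡ true) (sym h≡y₁) (sym w≡s) (sameEdge-flip y₁ s)) hw≢sy₁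
        where
        h≡y₁ : h ≡ y₁
        h≡y₁ = ∷ʳ-singleton pre (subst (λ xs → h ∷ xs ≡ pre ∷ʳ y₁) Qt≡[] ends)
    ... | hw∈G , _ | false with w ∈? (h ∷ Qt)
    ...   | no w∉ =
      search w (h ∷ Qt) (¬Any⇒All¬ (h ∷ Qt) w∉ ∷ u) (w∈S ∷ out) (Edge-sym (SimpleGraph.sym G) hw∈G , c)
             (w ∷ pre , cong (w ∷_) ends) u∈S walk
    ...   | yes w∈ with ∈-∃++ w∈
    ...     | ys , zs , split =
      search w zs (Unique-drop ys (subst Unique split u)) (++⁻ʳ ys (subst (All _) split out))
             (Chain-drop ys (subst (Chain (adj G)) (trans (cong (_++ s ∷ []) split) (++-assoc ys (w ∷ zs) (s ∷ []))) c))
             (∷ʳ-drop ys pre (trans (sym ends) split)) u∈S walk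

module Construction {n : ℕ} (G : SimpleGraph n) (2ec : TwoEdgeConnected G) (v₀ u₀ : Fin n)
  (e₀ : Edge (adj G) v₀ u₀) (avoiding : ∀ x y → x ≢ v₀ → y ≢ v₀ → Star (Avoiding G v₀) x y) where
  open Growth G v₀ u₀

  u₀≢v₀ : u₀ ≢ v₀
  u₀≢v₀ refl = ≡true⇒≢false e₀ (SimpleGraph.irrefl G v₀)

  attach-oriented : ∀ {S} (A : AbsorbingTree S) (ear : Ear S) → Ear.end ear ≢ v₀ →
    ∃[ S′ ] (AbsorbingTree S′ × S ⊂ᵇ S′)
  attach-oriented {S} A ear end≢v₀ with AbsorbingTree.vr A (Ear.start ear) ≤? AbsorbingTree.vr A (Ear.end ear)
  ... | yes start≤end = Attach.attached S A ear end≢v₀ start≤end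
  ... | no start≰end  = Attach.attached S A (reverse-ear ear) start≢v₀ (<⇒≤ end<start)
    where
    open AbsorbingTree A
    end<start : vr (Ear.end ear) < vr (Ear.start ear)
    end<start = ≰⇒> start≰end
    start≢v₀ : Ear.start ear ≢ v₀
    start≢v₀ refl = n≮0 (subst (vr (Ear.end ear) <_) vr-v₀ end<start)

  S₀ : VertexSet n
  S₀ = update ⁅ v₀ ⁆ u₀ true

  S₀-members : ∀ {v} → S₀ v ≡ true → v ≡ v₀ ⊎ v ≡ u₀
  S₀-members {v} h with v ≟ u₀ | v ≟ v₀
  ... | yes v≡u₀ | _        = inj₂ v≡u₀
  ... | no _     | yes v≡v₀ = inj₁ v≡v₀
  ... | no _     | no _     = ⊥-elim (≡true⇒≢false h refl)

  v₀∈S₀ : S₀ v₀ ≡ true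
  v₀∈S₀ = trans (update-other ⁅ v₀ ⁆ true (λ v₀≡u₀ → u₀≢v₀ (sym v₀≡u₀))) (update-here _ v₀ true)

  u₀∈S₀ : S₀ u₀ ≡ true
  u₀∈S₀ = update-here ⁅ v₀ ⁆ u₀ true

  T₀ : EdgeRel n
  T₀ a b = sameEdge a b v₀ u₀

  vr₀ : Fin n → ℕ
  vr₀ = update (λ _ → 2) v₀ 0

  vr₀-v₀ : vr₀ v₀ ≡ 0
  vr₀-v₀ = update-here _ v₀ 0

  vr₀-u₀ : vr₀ u₀ ≡ 2
  vr₀-u₀ = update-other _ 0 u₀≢v₀

  initial : AbsorbingTree S₀
  initial = record
    { T = T₀ ; vr = vr₀ ; er = λ _ _ → 1
    ; T-sym = λ a b → sameEdge-comm a b v₀ u₀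
    ; T⊆G = λ a b h → in-G (sameEdge-sound {a = a} {b} h)
    ; T⊆S = λ a b h → in-S₀ (sameEdge-sound {a = a} {b} h)
    ; v₀∈S = v₀∈S₀
    ; e₀∈T = sameEdge-refl v₀ u₀
    ; e₀-only = λ w h → only (sameEdge-sound {a = v₀} {w} h)
    ; er-sym = λ _ _ → refl
    ; vr-v₀ = vr₀-v₀
    ; er-e₀ = refl
    ; vr-late = λ v h v≢v₀ → subst (1 <_) (sym (update-other _ 0 v≢v₀)) (s≤s (s≤s z≤n))
    ; er-late = λ a b h ≢e₀ → ⊥-elim (≡true⇒≢false h ≢e₀)
    ; vr-inj = vr-inj
    ; er-inj = λ a b u v h₁ h₂ _ → sameEdge-trans {a = a} {b} {u} {v} {v₀} {u₀} h₁ h₂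
    ; ve-dis = λ w _ _ _ _ → vr₀≢1 w
    ; reachable = reachable
    ; absorbed = λ a b h ≢e₀ → ⊥-elim (≡true⇒≢false h ≢e₀)
    ; T-reaches = T-reaches }
    where
    in-G : ∀ {a b} → SameEnds a b v₀ u₀ → Edge (adj G) a b
    in-G (inj₁ (refl , refl)) = e₀
    in-G (inj₂ (refl , refl)) = Edge-sym (SimpleGraph.sym G) e₀
    in-S₀ : ∀ {a b} → SameEnds a b v₀ u₀ → S₀ a ≡ true
    in-S₀ (inj₁ (refl , refl)) = v₀∈S₀
    in-S₀ (inj₂ (refl , refl)) = u₀∈S₀
    only : ∀ {w} → SameEnds v₀ w v₀ u₀ → w ≡ u₀
    only (inj₁ (_ , w≡u₀))  = w≡u₀
    only (inj₂ (v₀≡u₀ , _)) = ⊥-elim (u₀≢v₀ (sym v₀≡u₀))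
    vr₀≢1 : ∀ w → vr₀ w ≢ 1
    vr₀≢1 w with w ≟ v₀
    ... | yes _ = λ ()
    ... | no _  = λ ()
    vr-inj : ∀ u v → S₀ u ≡ true → S₀ v ≡ true → vr₀ u ≡ vr₀ v → u ≡ v
    vr-inj u v hu hv eq with S₀-members {u} hu | S₀-members {v} hv
    ... | inj₁ refl | inj₁ refl = refl
    ... | inj₂ refl | inj₂ refl = refl
    ... | inj₁ refl | inj₂ refl with trans (sym vr₀-v₀) (trans eq vr₀-u₀)
    ...   | ()
    vr-inj u v hu hv eq | inj₂ refl | inj₁ refl with trans (sym vr₀-v₀) (trans (sym eq) vr₀-u₀)
    ...   | ()
    reachable : ∀ v → S₀ v ≡ true → v ≢ v₀ →
      ∃[ w ] (Edge (adj G) v w × S₀ w ≡ true × vr₀ w < vr₀ v × (T₀ v w ≡ false ⊎ 1 < vr₀ v))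
    reachable v h v≢v₀ with S₀-members {v} h
    ... | inj₁ v≡v₀ = ⊥-elim (v≢v₀ v≡v₀)
    ... | inj₂ refl = v₀ , Edge-sym (SimpleGraph.sym G) e₀ , v₀∈S₀ ,
                      subst₂ _<_ (sym vr₀-v₀) (sym vr₀-u₀) (s≤s z≤n) ,
                      inj₂ (subst (1 <_) (sym vr₀-u₀) (s≤s (s≤s z≤n)))
    T-reaches : ∀ v → S₀ v ≡ true → Star (Edge T₀) v v₀
    T-reaches v h with S₀-members {v} h
    ... | inj₁ refl = ε
    ... | inj₂ refl = sameEdge-flip u₀ v₀ ◅ ε

  grow : ∀ S → AbsorbingTree S → ∀ y → S y ≡ false → ∃[ S′ ] (AbsorbingTree S′ × S ⊂ᵇ S′)
  grow S A y y∉S = from-exit (exit-edge S (avoiding u₀ y u₀≢v₀ y≢v₀) u₀∈S y∉S)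
    where
    open AbsorbingTree A
    u₀∈S : S u₀ ≡ true
    u₀∈S = T⊆S u₀ v₀ (trans (T-sym u₀ v₀) e₀∈T)
    y≢v₀ : y ≢ v₀
    y≢v₀ refl = ≡true⇒≢false v₀∈S y∉S
    from-exit : ∃[ s ] ∃[ y₁ ] (Avoiding G v₀ s y₁ × S s ≡ true × S y₁ ≡ false) →
      ∃[ S′ ] (AbsorbingTree S′ × S ⊂ᵇ S′)
    from-exit (s , y₁ , (sy₁ , s≢v₀ , _) , s∈S , y₁∉S)
      with search s y₁ s∈S y₁ [] ([] ∷ []) (y₁∉S ∷ []) (Edge-sym (SimpleGraph.sym G) sy₁ , tt) ([] , refl)
                  u₀∈S (proj₂ 2ec s y₁ sy₁ y₁ u₀)
    ... | ear , refl = attach-oriented A ear s≢v₀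

  spanning-absorbing-tree : ∃[ S ] (AbsorbingTree S × ∀ v → S v ≡ true)
  spanning-absorbing-tree = saturate AbsorbingTree grow S₀ initial

proposition4p6 : ∀ (n : ℕ) (G : SimpleGraph n) → 2 ≤ n → TwoEdgeConnected G →
    ∃[ T ] (IsSpanningTree G T × HasAbsorptionOrder G T)
proposition4p6 n G 2≤n 2ec with non-cut-vertex G 2≤n (proj₁ 2ec)
... | v₀ , u₀ , e₀ , avoiding with Construction.spanning-absorbing-tree G 2ec v₀ u₀ e₀ avoiding
...   | S , A , full = T , is-spanning-tree A full , has-absorption-order A full
  where open Growth G v₀ u₀
        open AbsorbingTree A using (T)
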